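{- Let $V$ be a word in the letters $\uparrow,\downarrow$ containing exactly $d$ letters $\downarrow$, whose final letter is $\downarrow$, and let $H$ be a word in the letters $\rightarrow,\leftarrow$. Then for every shuffle $\sigma$ of $V$ and $H$, the shifted In-Vert of the flip $f(\sigma)$ equals the signed peak-count of $\sigma$.
   Context: A shuffle of $V$ and $H$ is an interleaving of the letters of $V$ and $H$ (each preserving its internal order); by convention every shuffle is written with an extra symbol $\swarrow$ in its zero-th position, preceding the first step. For sets $A,B$ of symbols, $\#(A,B)_\sigma$ denotes the number of positions in $\sigma$ where an element of $A$ is immediately followed by an element of $B$. Let $I=\{\leftarrow,\downarrow,\swarrow\}$ (inward steps) and $O=\{\rightarrow,\uparrow\}$ (outward steps). The signed peak-count of $\sigma$ is $\#(\uparrow,\leftarrow)_\sigma - \#(\rightarrow,\downarrow)_\sigma$. The shifted In-Vert of $\sigma$ is $\#(I,\{\uparrow,\downarrow\})_\sigma - d$. An out-run of $\sigma$ is a nonempty maximal contiguous block of outward steps; the flip $f(\sigma)$ is the shuffle obtained from $\sigma$ by writing every out-run in reverse order (all other letters stay in place). -}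

module Defs where

open import Data.Bool using (Bool; true; false; _∧_; if_then_else_)
open import Data.Nat using (ℕ; zero; suc)
open import Data.List using (List; []; _∷_; _++_; map)

data VLetter : Set where
  up down : VLetter

data HLetter : Set where
  right left : HLetter

data Step : Set where
  U D R L : Step

vStep : VLetter → Step
vStep up = U
vStep down = D

hStep : HLetter → Step
hStep right = R
hStep left = L

data Shuffle : List VLetter → List HLetter → List Step → Set where
  []  : Shuffle [] [] []
  vcons : ∀ {V H σ} (v : VLetter) → Shuffle V H σ → Shuffle (v ∷ V) H (vStep v ∷ σ)
  hcons : ∀ {V H σ} (h : HLetter) → Shuffle V H σ → Shuffle V (h ∷ H) (hStep h ∷ σ)

-- Symbols of the written shuffle: the extra symbol ↙ at position zero, then steps.
data Sym : Set where
  ↙ : Sym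
  st : Step → Sym

written : List Step → List Sym
written σ = ↙ ∷ map st σ

pairCount : (Sym → Bool) → (Sym → Bool) → List Sym → ℕ
pairCount A B [] = zero
pairCount A B (x ∷ []) = zero
pairCount A B (x ∷ y ∷ xs) =
  if A x ∧ B y then suc (pairCount A B (y ∷ xs)) else pairCount A B (y ∷ xs)

isUp isDown isRight isLeft : Sym → Bool
isUp (st U) = true
isUp _ = false
isDown (st D) = true
isDown _ = false
isRight (st R) = true
isRight _ = false
isLeft (st L) = true
isLeft _ = false

inward : Sym → Bool
inward ↙ = true
inward (st L) = true
inward (st D) = true
inward _ = false

vertical : Sym → Bool
vertical (st U) = true
vertical (st D) = true
vertical _ = false

outward : Step → Bool
outward R = true
outward U = true
outward _ = false

countDown : List VLetter → ℕ
countDown [] = zero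
countDown (up ∷ V) = countDown V
countDown (down ∷ V) = suc (countDown V)

-- Flip: reverse every maximal out-run. The accumulator holds the current
-- out-run already reversed. (↙ is inward, so it never belongs to an out-run.)
flipGo : List Step → List Step → List Step
flipGo acc [] = acc
flipGo acc (x ∷ xs) with outward x
... | true  = flipGo (x ∷ acc) xs
... | false = acc ++ (x ∷ flipGo [] xs)

flip : List Step → List Step
flip σ = flipGo [] σ

module Submission where

-- Cut σ into maximal out-runs separated by inward steps:
--   σ = w₀ y₁ w₁ y₂ … y_k w_k,   each wᵢ ⊆ {→,↑}*,  each yᵢ ∈ {↓,←},
-- and write the symbol ↙ in front.  The flip reverses each wᵢ in place.
-- Each of the four counts #(I,{↑,↓}) ∘ f, #(→,↓), #(Sym,↓) (= the number d
-- of ↓'s) and #(↑,←) is additive over this decomposition: inside a run,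
-- and at the step out of a run, no pair is counted, so a gap "x wᵢ yᵢ₊₁"
-- only contributes through its last letter before yᵢ₊₁ (in σ) resp. its
-- first letter after x (in f σ, i.e. the last letter of wᵢ).  A finite
-- case check shows that every gap is balanced:
--   In-Vert + #(→,↓) = #↓ + #(↑,←),
-- and the final run w_k contributes the defect [σ ends with ↑].  Since V
-- ends with ↓, a shuffle of V and H never ends with ↑, which gives the
-- theorem after moving to ℤ.

open import Defs
open import Algebra.Properties.CommutativeSemigroup using (interchange)
open import Data.Bool using (Bool; true; false; _∧_)
open import Data.Integer using (+_; _-_; _⊖_)
import Data.Integer.Properties as ℤ
open import Data.List using (List; []; _∷_; _++_; map; _ʳ++_)
open import Data.List.Properties using (++-identityʳ; ʳ++-defn)
open import Data.List.Relation.Unary.All using (All; []; _∷_)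
open import Data.Nat using (ℕ; suc; _+_)
import Data.Nat.Properties as ℕ
open import Data.Product using (∃; _,_)
open import Function using (const)
open import Relation.Binary.PropositionalEquality
  using (_≡_; refl; sym; trans; cong; cong₂; module ≡-Reasoning)

open ≡-Reasoning

data Outward : Sym → Set where
  out↑ : Outward (st U)
  out→ : Outward (st R)

data Inward : Sym → Set where
  in↙ : Inward ↙
  in↓ : Inward (st D)
  in← : Inward (st L)

OutRun : List Step → Set
OutRun = All (λ a → Outward (st a))

FalseOnOutward : (Sym → Bool) → Set
FalseOnOutward P = ∀ {z} → Outward z → P z ≡ false

count : (Sym → Bool) → (Sym → Bool) → Sym → List Step → ℕ
count A B x τ = pairCount A B (x ∷ map st τ)

-- The four statistics of the theorem (with the prefix symbol x in place
-- of ↙): In-Vert, #(→,↓), the number of ↓'s, and #(↑,←).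
inVert rightDown downs upLeft : Sym → List Step → ℕ
inVert    = count inward vertical
rightDown = count isRight isDown
downs     = count (const true) isDown
upLeft    = count isUp isLeft

lastOr : Sym → List Step → Sym
lastOr x [] = x
lastOr x (a ∷ τ) = lastOr (st a) τ

upIndicator : Sym → ℕ
upIndicator (st U) = 1
upIndicator _ = 0

endsWithUp : Sym → List Step → ℕ
endsWithUp x τ = upIndicator (lastOr x τ)

skipFirst : ∀ A B {x} (l : List Sym) → A x ≡ false →
  pairCount A B (x ∷ l) ≡ pairCount A B l
skipFirst A B [] notA = refl
skipFirst A B (y ∷ l) notA rewrite notA = refl

skipSecond : ∀ A B {x y} (l : List Sym) → B y ≡ false →
  pairCount A B (x ∷ y ∷ l) ≡ pairCount A B (y ∷ l)
skipSecond A B {x} l notB with A x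
... | false = refl
... | true rewrite notB = refl

splitFirstPair : ∀ A B {x y} (l : List Sym) →
  pairCount A B (x ∷ y ∷ l) ≡ pairCount A B (x ∷ y ∷ []) + pairCount A B (y ∷ l)
splitFirstPair A B {x} {y} l with A x ∧ B y
... | true = refl
... | false = refl

skipRun : ∀ A B {x w} ys → FalseOnOutward B → OutRun w →
  count A B x (w ++ ys) ≡ count A B (lastOr x w) ys
skipRun A B ys notB [] = refl
skipRun A B {w = _ ∷ w} ys notB (o ∷ os) =
  trans (skipSecond A B (map st (w ++ ys)) (notB o)) (skipRun A B ys notB os)

runThenStep : ∀ A B {x w y} xs → FalseOnOutward B → OutRun w →
  count A B x (w ++ y ∷ xs)
    ≡ pairCount A B (lastOr x w ∷ st y ∷ []) + count A B (st y) xs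
runThenStep A B xs notB ow =
  trans (skipRun A B (_ ∷ xs) notB ow) (splitFirstPair A B (map st xs))

silentRun : ∀ A B {x w} → FalseOnOutward B → OutRun w → count A B x w ≡ 0
silentRun A B {x} {w} notB ow =
  trans (cong (count A B x) (sym (++-identityʳ w))) (skipRun A B [] notB ow)

-- Dually, if A fails on outward letters, a reversed out-run w only matters
-- through its first letter, which is the last letter of w.
reversedRun : ∀ A B {x w y} ys → FalseOnOutward A → OutRun w →
  count A B x (w ʳ++ y ∷ ys)
    ≡ pairCount A B (x ∷ lastOr (st y) w ∷ []) + count A B (st y) ys
reversedRun A B ys notA [] = splitFirstPair A B (map st ys)
reversedRun A B {x} {a ∷ w} {y} ys notA (o ∷ os) =
  trans (reversedRun A B (y ∷ ys) notA os)
        (cong (_+_ (pairCount A B (x ∷ lastOr (st a) w ∷ [])))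
              (skipFirst A B (map st (y ∷ ys)) (notA o)))

lastOr-outward : ∀ {x w} → Outward x → OutRun w → Outward (lastOr x w)
lastOr-outward o [] = o
lastOr-outward o (o′ ∷ os) = lastOr-outward o′ os

lastOr-gap : ∀ x w {y} xs → lastOr x (w ++ y ∷ xs) ≡ lastOr (st y) xs
lastOr-gap x [] xs = refl
lastOr-gap x (a ∷ w) xs = lastOr-gap (st a) w xs

flipGo-run : ∀ {acc w} xs → OutRun w → flipGo acc (w ++ xs) ≡ flipGo (w ʳ++ acc) xs
flipGo-run xs [] = refl
flipGo-run xs (out↑ ∷ os) = flipGo-run xs os
flipGo-run xs (out→ ∷ os) = flipGo-run xs os

flipGo-inward : ∀ {y} acc xs → Inward (st y) → flipGo acc (y ∷ xs) ≡ acc ++ y ∷ flip xs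
flipGo-inward acc xs in↓ = refl
flipGo-inward acc xs in← = refl

flip-gap : ∀ {w y} xs → OutRun w → Inward (st y) → flip (w ++ y ∷ xs) ≡ w ʳ++ y ∷ flip xs
flip-gap {w} {y} xs ow j = begin
  flipGo [] (w ++ y ∷ xs)   ≡⟨ flipGo-run (y ∷ xs) ow ⟩
  flipGo (w ʳ++ []) (y ∷ xs) ≡⟨ flipGo-inward (w ʳ++ []) xs j ⟩
  (w ʳ++ []) ++ y ∷ flip xs  ≡⟨ sym (ʳ++-defn w) ⟩
  w ʳ++ y ∷ flip xs          ∎

flip-final : ∀ {w} → OutRun w → flip w ≡ w ʳ++ []
flip-final {w} ow = trans (cong flip (sym (++-identityʳ w))) (flipGo-run [] ow)

inwardFalseOnOutward : FalseOnOutward inward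
inwardFalseOnOutward out↑ = refl
inwardFalseOnOutward out→ = refl

isDownFalseOnOutward : FalseOnOutward isDown
isDownFalseOnOutward out↑ = refl
isDownFalseOnOutward out→ = refl

isLeftFalseOnOutward : FalseOnOutward isLeft
isLeftFalseOnOutward out↑ = refl
isLeftFalseOnOutward out→ = refl

afterInward : ∀ {x z} → Inward x → Outward z →
  pairCount inward vertical (x ∷ z ∷ []) ≡ upIndicator z
afterInward in↙ out↑ = refl
afterInward in↙ out→ = refl
afterInward in↓ out↑ = refl
afterInward in↓ out→ = refl
afterInward in← out↑ = refl
afterInward in← out→ = refl

inwardNotUp : ∀ {x} → Inward x → upIndicator x ≡ 0
inwardNotUp in↙ = refl
inwardNotUp in↓ = refl
inwardNotUp in← = refl

gapEmpty : ∀ {x y} → Inward x → Inward (st y) →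
  pairCount inward vertical (x ∷ st y ∷ []) + pairCount isRight isDown (x ∷ st y ∷ [])
    ≡ pairCount (const true) isDown (x ∷ st y ∷ []) + pairCount isUp isLeft (x ∷ st y ∷ [])
gapEmpty in↙ in↓ = refl
gapEmpty in↙ in← = refl
gapEmpty in↓ in↓ = refl
gapEmpty in↓ in← = refl
gapEmpty in← in↓ = refl
gapEmpty in← in← = refl

gapRun : ∀ {x z y} → Inward x → Outward z → Inward (st y) →
  pairCount inward vertical (x ∷ z ∷ []) + pairCount isRight isDown (z ∷ st y ∷ [])
    ≡ pairCount (const true) isDown (z ∷ st y ∷ []) + pairCount isUp isLeft (z ∷ st y ∷ [])
gapRun i o j = trans (cong (_+ _) (afterInward i o)) (lastRunLetter o j)
  where
  lastRunLetter : ∀ {z y} → Outward z → Inward (st y) →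
    upIndicator z + pairCount isRight isDown (z ∷ st y ∷ [])
      ≡ pairCount (const true) isDown (z ∷ st y ∷ []) + pairCount isUp isLeft (z ∷ st y ∷ [])
  lastRunLetter out↑ in↓ = refl
  lastRunLetter out↑ in← = refl
  lastRunLetter out→ in↓ = refl
  lastRunLetter out→ in← = refl

gapBalanced : ∀ {x w y} → Inward x → OutRun w → Inward (st y) →
  pairCount inward vertical (x ∷ lastOr (st y) w ∷ []) + pairCount isRight isDown (lastOr x w ∷ st y ∷ [])
    ≡ pairCount (const true) isDown (lastOr x w ∷ st y ∷ []) + pairCount isUp isLeft (lastOr x w ∷ st y ∷ [])
gapBalanced i [] j = gapEmpty i j
gapBalanced i (o ∷ os) j = gapRun i (lastOr-outward o os) j

finalRun : ∀ {x w} → Inward x → OutRun w → inVert x (w ʳ++ []) ≡ endsWithUp x w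
finalRun i [] = sym (inwardNotUp i)
finalRun i (o ∷ os) =
  trans (reversedRun inward vertical [] inwardFalseOnOutward os)
        (trans (ℕ.+-identityʳ _) (afterInward i (lastOr-outward o os)))

data Runs : List Step → Set where
  final : ∀ {w} → OutRun w → Runs w
  gap   : ∀ {w y xs} → OutRun w → Inward (st y) → Runs xs → Runs (w ++ y ∷ xs)

prependOutward : ∀ {a σ} → Outward (st a) → Runs σ → Runs (a ∷ σ)
prependOutward o (final ow) = final (o ∷ ow)
prependOutward o (gap ow j r) = gap (o ∷ ow) j r

runs : ∀ σ → Runs σ
runs [] = final []
runs (U ∷ σ) = prependOutward out↑ (runs σ)
runs (R ∷ σ) = prependOutward out→ (runs σ)
runs (D ∷ σ) = gap [] in↓ (runs σ)
runs (L ∷ σ) = gap [] in← (runs σ)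

additivity : ∀ {i r d u e} (i₁ r₁ d₁ u₁ i₂ r₂ d₂ u₂ : ℕ) {e₂} →
  i ≡ i₁ + i₂ → r ≡ r₁ + r₂ → d ≡ d₁ + d₂ → u ≡ u₁ + u₂ → e ≡ e₂ →
  i₁ + r₁ ≡ d₁ + u₁ → i₂ + r₂ ≡ (d₂ + u₂) + e₂ → i + r ≡ (d + u) + e
additivity {e = e} i₁ r₁ d₁ u₁ i₂ r₂ d₂ u₂
  refl refl refl refl refl balanced₁ balanced₂ = begin
  (i₁ + i₂) + (r₁ + r₂)          ≡⟨ interchange ℕ.+-commutativeSemigroup i₁ i₂ r₁ r₂ ⟩
  (i₁ + r₁) + (i₂ + r₂)          ≡⟨ cong₂ _+_ balanced₁ balanced₂ ⟩
  (d₁ + u₁) + ((d₂ + u₂) + e)    ≡⟨ sym (ℕ.+-assoc (d₁ + u₁) (d₂ + u₂) e) ⟩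
  ((d₁ + u₁) + (d₂ + u₂)) + e    ≡⟨ cong (_+ e) (interchange ℕ.+-commutativeSemigroup d₁ u₁ d₂ u₂) ⟩
  ((d₁ + d₂) + (u₁ + u₂)) + e    ∎

balance : ∀ {x σ} → Inward x → Runs σ →
  inVert x (flip σ) + rightDown x σ ≡ (downs x σ + upLeft x σ) + endsWithUp x σ
balance {x} i (final {w} ow) = begin
  inVert x (flip w) + rightDown x w
    ≡⟨ cong₂ _+_ (trans (cong (inVert x) (flip-final ow)) (finalRun i ow))
                 (silentRun isRight isDown isDownFalseOnOutward ow) ⟩
  endsWithUp x w + 0
    ≡⟨ ℕ.+-comm (endsWithUp x w) 0 ⟩
  0 + endsWithUp x w
    ≡⟨ cong (_+ endsWithUp x w)
            (sym (cong₂ _+_ (silentRun (const true) isDown isDownFalseOnOutward ow)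
                            (silentRun isUp isLeft isLeftFalseOnOutward ow))) ⟩
  (downs x w + upLeft x w) + endsWithUp x w ∎
balance {x} i (gap {w} {y} {xs} ow j r) =
  additivity gapInVert (gapCount isRight isDown) (gapCount (const true) isDown)
             (gapCount isUp isLeft)
             (inVert (st y) (flip xs)) (rightDown (st y) xs) (downs (st y) xs) (upLeft (st y) xs)
    (trans (cong (inVert x) (flip-gap xs ow j))
           (reversedRun inward vertical (flip xs) inwardFalseOnOutward ow))
    (runThenStep isRight isDown xs isDownFalseOnOutward ow)
    (runThenStep (const true) isDown xs isDownFalseOnOutward ow)
    (runThenStep isUp isLeft xs isLeftFalseOnOutward ow)
    (cong upIndicator (lastOr-gap x w xs))
    (gapBalanced i ow j)
    (balance j r)
  where
  gapInVert : ℕ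
  gapInVert = pairCount inward vertical (x ∷ lastOr (st y) w ∷ [])
  gapCount : (Sym → Bool) → (Sym → Bool) → ℕ
  gapCount A B = pairCount A B (lastOr x w ∷ st y ∷ [])

downsShuffle : ∀ {V H σ} x → Shuffle V H σ → downs x σ ≡ countDown V
downsShuffle x [] = refl
downsShuffle x (vcons up s) = downsShuffle (st U) s
downsShuffle x (vcons down s) = cong suc (downsShuffle (st D) s)
downsShuffle x (hcons right s) = downsShuffle (st R) s
downsShuffle x (hcons left s) = downsShuffle (st L) s

horizontalNotEndingUp : ∀ {H σ x} → Shuffle [] H σ → upIndicator x ≡ 0 → endsWithUp x σ ≡ 0
horizontalNotEndingUp [] notUp = notUp
horizontalNotEndingUp (hcons right s) notUp = horizontalNotEndingUp s refl
horizontalNotEndingUp (hcons left s) notUp = horizontalNotEndingUp s refl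

-- If V ends with ↓, no shuffle of V and H ends with ↑: after the last ↓
-- only horizontal steps follow.
shuffleNotEndingUp : ∀ V′ {H σ} x → Shuffle (V′ ++ down ∷ []) H σ → endsWithUp x σ ≡ 0
shuffleNotEndingUp [] x (vcons down s) = horizontalNotEndingUp s refl
shuffleNotEndingUp (up ∷ V′) x (vcons up s) = shuffleNotEndingUp V′ (st U) s
shuffleNotEndingUp (down ∷ V′) x (vcons down s) = shuffleNotEndingUp V′ (st D) s
shuffleNotEndingUp V′ x (hcons right s) = shuffleNotEndingUp V′ (st R) s
shuffleNotEndingUp V′ x (hcons left s) = shuffleNotEndingUp V′ (st L) s

balanceToDifference : ∀ a b c d → a + c ≡ d + b → + a - + d ≡ + b - + c
balanceToDifference a b c d balanced = begin
  + a - + d           ≡⟨ ℤ.m-n≡m⊖n a d ⟩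
  a ⊖ d               ≡⟨ sym (ℤ.+-cancelˡ-⊖ c a d) ⟩
  (c + a) ⊖ (c + d)   ≡⟨ cong₂ _⊖_ (trans (ℕ.+-comm c a) balanced) (ℕ.+-comm c d) ⟩
  (d + b) ⊖ (d + c)   ≡⟨ ℤ.+-cancelˡ-⊖ d b c ⟩
  b ⊖ c               ≡⟨ sym (ℤ.m-n≡m⊖n b c) ⟩
  + b - + c           ∎

proposition2p14 : (d : ℕ) (V : List VLetter) (H : List HLetter) (σ : List Step) →
    countDown V ≡ d →
    ∃ (λ V′ → V ≡ V′ ++ (down ∷ [])) →
    Shuffle V H σ →
    (+ pairCount inward vertical (written (flip σ))) - (+ d)
      ≡ (+ pairCount isUp isLeft (written σ)) - (+ pairCount isRight isDown (written σ))
proposition2p14 d V H σ refl (V′ , refl) s =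
  balanceToDifference (inVert ↙ (flip σ)) (upLeft ↙ σ) (rightDown ↙ σ) d (begin
    inVert ↙ (flip σ) + rightDown ↙ σ          ≡⟨ balance in↙ (runs σ) ⟩
    (downs ↙ σ + upLeft ↙ σ) + endsWithUp ↙ σ  ≡⟨ cong₂ _+_ (cong (_+ upLeft ↙ σ) (downsShuffle ↙ s))
                                                             (shuffleNotEndingUp V′ ↙ s) ⟩
    (d + upLeft ↙ σ) + 0                       ≡⟨ ℕ.+-identityʳ (d + upLeft ↙ σ) ⟩
    d + upLeft ↙ σ                             ∎)
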